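{- Let $p$ and $q$ be relatively prime positive integers, exactly one of which is even. For every integer $n\geq pq+(p-1)(q-1)$, there exist nonnegative integers $a$ and $b$ such that $n=ap+bq$ and $a+b$ is even. -}

module Defs where

module Submission where

-- Because P and Q are coprime, q is
-- invertible modulo P (Bézout), so every residue modulo P is attained by
-- some b * Q with b < P; subtracting b * Q from n then leaves a multiple
-- of P, and we obtain  n = a * P + b * Q  with  b < P  as soon as
-- (P - 1) * Q ≤ n.  The hypothesis  n ≥ P * Q + (P - 1) * (Q - 1)
-- exceeds the largest value  (Q - 1) * P + (P - 1) * Q  of such a
-- combination with a < Q, so in fact a ≥ Q.  Finally P + Q is odd, so
-- trading Q copies of P for P copies of Q, i.e. passing from (a , b) to
-- (a - Q , b + P), changes the parity of the coefficient sum: one of the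
-- two representations has an even sum.

open import Defs
open import Data.Nat using (ℕ; _+_; _*_; _∸_; _≤_; _<_)
open import Data.Nat.Divisibility using (_∣_)
open import Data.Nat.Coprimality using (Coprime)
open import Data.Product using (Σ; _×_; ∃₂)
open import Data.Sum using (_⊎_)
open import Relation.Nullary using (¬_)
open import Relation.Binary.PropositionalEquality using (_≡_)

open import Data.Nat using (suc; zero; _%_; _/_; _≤?_; NonZero; s≤s; z≤n)
open import Data.Nat.Properties
open import Data.Nat.DivMod
open import Data.Nat.Divisibility using (_∣?_; divides; m%n≡0⇒n∣m; ∣m+n∣m⇒∣n)
open import Data.Nat.Coprimality using (coprime-Bézout)
open import Data.Nat.GCD using (module Bézout)
open import Data.Nat.Tactic.RingSolver using (solve-∀)
open import Data.Product using (_,_; ∃)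
open import Data.Sum using (inj₁; inj₂)
open import Data.Empty using (⊥-elim)
open import Relation.Nullary using (yes; no)
open import Relation.Binary.PropositionalEquality
  using (refl; sym; trans; cong; cong₂; subst; module ≡-Reasoning)

odd⇒%2≡1 : ∀ x → ¬ (2 ∣ x) → x % 2 ≡ 1
odd⇒%2≡1 x odd with x % 2 | m%n<n x 2 | m%n≡0⇒n∣m x 2
... | zero        | _                  | even = ⊥-elim (odd (even refl))
... | suc zero    | _                  | _    = refl
... | suc (suc _) | s≤s (s≤s ())       | _

odd+odd⇒even : ∀ x y → ¬ (2 ∣ x) → ¬ (2 ∣ y) → 2 ∣ (x + y)
odd+odd⇒even x y ox oy = m%n≡0⇒n∣m (x + y) 2 (begin
  (x + y) % 2           ≡⟨ %-distribˡ-+ x y 2 ⟩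
  (x % 2 + y % 2) % 2   ≡⟨ cong₂ (λ u v → (u + v) % 2) (odd⇒%2≡1 x ox) (odd⇒%2≡1 y oy) ⟩
  0                     ∎)
  where open ≡-Reasoning

one-even⇒sum-odd : ∀ x y → ((2 ∣ x × ¬ (2 ∣ y)) ⊎ (¬ (2 ∣ x) × 2 ∣ y)) →
  ¬ (2 ∣ (x + y))
one-even⇒sum-odd x y (inj₁ (ex , oy)) 2∣x+y = oy (∣m+n∣m⇒∣n 2∣x+y ex)
one-even⇒sum-odd x y (inj₂ (ox , ey)) 2∣x+y =
  ox (∣m+n∣m⇒∣n (subst (2 ∣_) (+-comm x y) 2∣x+y) ey)

-- A number coprime to P is invertible modulo P.  Bézout gives either
-- 1 + x P = y q (so y is an inverse) or 1 + y q = x P (so y q ≡ -1 and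
-- (P - 1) y is an inverse).
inverse-mod : ∀ P q .{{_ : NonZero P}} → Coprime P q →
  ∃ λ y → (y * q) % P ≡ 1 % P
inverse-mod P q c with coprime-Bézout c
... | Bézout.-+ x y 1+xP≡yq = y , (begin
  (y * q) % P         ≡⟨ cong (_% P) (sym 1+xP≡yq) ⟩
  (1 + x * P) % P     ≡⟨ [m+kn]%n≡m%n 1 x P ⟩
  1 % P               ∎)
  where open ≡-Reasoning
inverse-mod P@(suc p') q c | Bézout.+- x y 1+yq≡xP = p' * y , (begin
  (p' * y * q) % P               ≡⟨ [m+kn]%n≡m%n (p' * y * q) 1 P ⟨
  (p' * y * q + 1 * P) % P       ≡⟨ cong (_% P) (flip p' y q) ⟩
  (1 + p' * (1 + y * q)) % P     ≡⟨ cong (λ t → (1 + p' * t) % P) 1+yq≡xP ⟩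
  (1 + p' * (x * P)) % P         ≡⟨ cong (λ t → (1 + t) % P) (sym (*-assoc p' x P)) ⟩
  (1 + p' * x * P) % P           ≡⟨ [m+kn]%n≡m%n 1 (p' * x) P ⟩
  1 % P                          ∎)
  where
  open ≡-Reasoning
  flip : ∀ p' y q → p' * y * q + 1 * suc p' ≡ 1 + p' * (1 + y * q)
  flip = solve-∀

residue-attained : ∀ P q .{{_ : NonZero P}} → Coprime P q → ∀ r →
  ∃ λ b → b < P × (b * q) % P ≡ r % P
residue-attained P q c r with inverse-mod P q c
... | y , yq≡1 = r * y % P , m%n<n (r * y) P , (begin
  (r * y % P * q) % P              ≡⟨ %-distribˡ-* (r * y % P) q P ⟩
  (r * y % P % P * (q % P)) % P    ≡⟨ cong (λ t → (t * (q % P)) % P) (m%n%n≡m%n (r * y) P) ⟩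
  (r * y % P * (q % P)) % P        ≡⟨ %-distribˡ-* (r * y) q P ⟨
  (r * y * q) % P                  ≡⟨ cong (_% P) (*-assoc r y q) ⟩
  (r * (y * q)) % P                ≡⟨ %-distribˡ-* r (y * q) P ⟩
  (r % P * ((y * q) % P)) % P      ≡⟨ cong (λ t → (r % P * t) % P) yq≡1 ⟩
  (r % P * (1 % P)) % P            ≡⟨ %-distribˡ-* r 1 P ⟨
  (r * 1) % P                      ≡⟨ cong (_% P) (*-identityʳ r) ⟩
  r % P                            ∎)
  where open ≡-Reasoning

congruent⇒differ-by-multiple : ∀ m n P .{{_ : NonZero P}} → m ≤ n →
  m % P ≡ n % P → n ≡ (n / P ∸ m / P) * P + m
congruent⇒differ-by-multiple m n P m≤n m≡n = begin
  n                                          ≡⟨ m≡m%n+[m/n]*n n P ⟩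
  n % P + n / P * P                          ≡⟨ cong₂ _+_ (sym m≡n) (sym quotients) ⟩
  m % P + ((n / P ∸ m / P) * P + m / P * P)  ≡⟨ swap (m % P) ((n / P ∸ m / P) * P) (m / P * P) ⟩
  (n / P ∸ m / P) * P + (m % P + m / P * P)  ≡⟨ cong ((n / P ∸ m / P) * P +_) (m≡m%n+[m/n]*n m P) ⟨
  (n / P ∸ m / P) * P + m                    ∎
  where
  open ≡-Reasoning
  quotients : (n / P ∸ m / P) * P + m / P * P ≡ n / P * P
  quotients = trans (cong (_+ m / P * P) (*-distribʳ-∸ P (n / P) (m / P)))
                    (m∸n+n≡m (*-monoˡ-≤ P (/-monoˡ-≤ P m≤n)))
  swap : ∀ u v w → u + (v + w) ≡ v + (u + w)
  swap = solve-∀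

representation : ∀ P q .{{_ : NonZero P}} → Coprime P q →
  ∀ n → (P ∸ 1) * q ≤ n → ∃₂ λ a b → b < P × n ≡ a * P + b * q
representation P q c n bound with residue-attained P q c n
... | b , b<P , bq≡n = n / P ∸ (b * q) / P , b , b<P ,
  congruent⇒differ-by-multiple (b * q) n P bq≤n bq≡n
  where
  bq≤n : b * q ≤ n
  bq≤n = ≤-trans (*-monoˡ-≤ q (suc[m]≤n⇒m≤pred[n] b<P)) bound

-- Combinations a P + b Q with a < Q and b < P are at most
-- (Q - 1) P + (P - 1) Q, which is one less than P Q + (P - 1)(Q - 1).
-- So a representation of a number above that bound has a ≥ Q.
first-coefficient-large : ∀ P Q a b n → b < P → n ≡ a * P + b * Q →
  P * Q + (P ∸ 1) * (Q ∸ 1) ≤ n → Q ≤ a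
first-coefficient-large _ zero _ _ _ _ _ _ = z≤n
first-coefficient-large (suc p') (suc q') a b n (s≤s b≤p') refl bound
  with suc q' ≤? a
... | yes Q≤a = Q≤a
... | no Q≰a = ⊥-elim (<-irrefl refl (≤-<-trans bound too-small))
  where
  a≤q' : a ≤ q'
  a≤q' = suc[m]≤n⇒m≤pred[n] (≰⇒> Q≰a)
  top : ∀ p' q' → suc p' * suc q' + p' * q' ≡ suc (q' * suc p' + p' * suc q')
  top = solve-∀
  too-small : a * suc p' + b * suc q' < suc p' * suc q' + p' * q'
  too-small = subst (a * suc p' + b * suc q' <_) (sym (top p' q'))
    (s≤s (+-mono-≤ (*-monoˡ-≤ (suc p') a≤q') (*-monoˡ-≤ (suc q') b≤p')))

-- Parity exchange: if P + Q is odd and a ≥ Q, then either (a , b) or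
-- (a - Q , b + P) represents a P + b Q with an even coefficient sum,
-- since the two coefficient sums differ by P - Q.
even-representation : ∀ P Q a b → ¬ (2 ∣ (P + Q)) → Q ≤ a →
  ∃₂ λ a′ b′ → (a * P + b * Q ≡ a′ * P + b′ * Q) × (2 ∣ (a′ + b′))
even-representation P Q a b P+Q-odd Q≤a with m≤n⇒∃[o]m+o≡n Q≤a
... | k , refl with 2 ∣? (Q + k + b)
... | yes even = Q + k , b , refl , even
... | no odd = k , b + P , exchange P Q k b ,
  ∣m+n∣m⇒∣n (subst (2 ∣_) (sums P Q k b) (odd+odd⇒even _ _ odd P+Q-odd))
            (divides Q refl)
  where
  exchange : ∀ P Q k b → (Q + k) * P + b * Q ≡ k * P + (b + P) * Q
  exchange = solve-∀
  sums : ∀ P Q k b → (Q + k + b) + (P + Q) ≡ Q * 2 + (k + (b + P))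
  sums = solve-∀

corollary5 : (p q : ℕ) → 0 < p → 0 < q → Coprime p q →
    ((2 ∣ p × ¬ (2 ∣ q)) ⊎ (¬ (2 ∣ p) × 2 ∣ q)) →
    (n : ℕ) → p * q + (p ∸ 1) * (q ∸ 1) ≤ n →
    ∃₂ λ (a b : ℕ) → (n ≡ a * p + b * q) × (2 ∣ (a + b))
corollary5 p@(suc _) q _ _ coprime parities n bound
  with representation p q coprime n (≤-trans (*-monoˡ-≤ q (m∸n≤m p 1))
                                             (≤-trans (m≤m+n (p * q) _) bound))
... | a , b , b<p , n≡ap+bq
  with even-representation p q a b (one-even⇒sum-odd p q parities)
         (first-coefficient-large p q a b n b<p n≡ap+bq bound)
... | a′ , b′ , same , even = a′ , b′ , trans n≡ap+bq same , even
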